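{- A Toeplitz graph is regular if and only if it is a circulant graph.
   Context: A Toeplitz graph on $n$ vertices is a simple graph on vertex set $\{1,\ldots,n\}$ whose adjacency matrix is a symmetric $(0,1)$ Toeplitz matrix (constant along diagonals) with zero diagonal; equivalently, for $1 \le t_1 < \cdots < t_k < n$, $G_n\langle t_1,\ldots,t_k\rangle$ has $i \sim j$ iff $|i-j| \in \{t_1,\ldots,t_k\}$. A graph is circulant if it is isomorphic to a Toeplitz graph whose adjacency matrix is a symmetric $(0,1)$ circulant matrix $C_n = (c_{(i-j) \bmod n})_{i,j}$ with $c_0 = 0$ and $c_i = c_{n-i} \in \{0,1\}$ for $i = 1, \ldots, \lfloor n/2 \rfloor$. Here "a Toeplitz graph is a circulant graph" means its adjacency matrix (in the given labeling) is of this circulant form. -}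

module Defs where

open import Data.Bool using (Bool; true; false; if_then_else_)
open import Data.Nat using (ℕ; zero; suc; _+_; _∸_; _≤_; _<_; _≡ᵇ_; _≤ᵇ_; ∣_-_∣)
open import Data.Fin using (Fin; toℕ)
open import Data.List using (List; length; filterᵇ; allFin)
open import Data.Bool.ListAction using (any)
open import Data.Product using (Σ; ∃; _×_)
open import Relation.Binary.PropositionalEquality using (_≡_)

AdjMatrix : ℕ → Set
AdjMatrix n = Fin n → Fin n → Bool

-- The Toeplitz graph G_n⟨t_1,…,t_k⟩ : i ∼ j iff |i - j| ∈ {t_1,…,t_k}.
-- (Vertex i of Fin n corresponds to vertex i+1 of {1,…,n}; differences are unchanged.)
toeplitzAdj : (n : ℕ) → List ℕ → AdjMatrix n
toeplitzAdj n ts i j = any (λ t → t ≡ᵇ ∣ toℕ i - toℕ j ∣) ts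

degree : {n : ℕ} → AdjMatrix n → Fin n → ℕ
degree {n} A i = length (filterᵇ (A i) (allFin n))

IsRegular : {n : ℕ} → AdjMatrix n → Set
IsRegular A = ∃ λ d → ∀ i → degree A i ≡ d

-- (i - j) mod n for 0 ≤ i, j < n, written out without the division operator.
diffMod : ℕ → ℕ → ℕ → ℕ
diffMod n i j = if j ≤ᵇ i then i ∸ j else (n + i) ∸ j

IsCirculant : {n : ℕ} → AdjMatrix n → Set
IsCirculant {n} A =
  Σ (ℕ → Bool) λ c →
    (c 0 ≡ false)
    × (∀ i → 1 ≤ i → i < n → c i ≡ c (n ∸ i))
    × (∀ (i j : Fin n) → A i j ≡ c (diffMod n (toℕ i) (toℕ j)))

data StrictlyIncreasingIn (n : ℕ) : ℕ → List ℕ → Set where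
  []  : ∀ {lo} → StrictlyIncreasingIn n lo List.[]
  _∷_ : ∀ {lo t ts} → (lo ≤ t × t < n) → StrictlyIncreasingIn n (suc t) ts →
        StrictlyIncreasingIn n lo (t List.∷ ts)

ToeplitzParams : ℕ → List ℕ → Set
ToeplitzParams n ts = StrictlyIncreasingIn n 1 ts

{-# OPTIONS --safe #-}

-- Write s for the indicator function of {t₁, …, t_k} (with s 0 = false), so that
-- vertices i and j are adjacent iff s ∣i − j∣. Vertex i sees the distances i, …, 0
-- on its left and 1, …, n − 1 − i on its right, hence
--   deg (i + 1) − deg i = s (i + 1) − s (n − 1 − i).
-- So the graph is regular iff s t = s (n − t) for 0 < t < n. Since (i − j) mod n is
-- either ∣i − j∣ or n − ∣i − j∣, that symmetry is also exactly what makes the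
-- matrix (s ∣i − j∣) circulant, with c = s.
module Submission where

open import Defs
open import Data.Bool using (Bool; true; false; _∨_)
open import Data.Bool.ListAction using (any)
open import Data.Fin using (Fin; toℕ; fromℕ<)
open import Data.Fin.Properties using (toℕ<n; toℕ-fromℕ<)
open import Data.List using (List; []; _∷_; length; filterᵇ; tabulate)
open import Data.Nat using (ℕ; zero; suc; _+_; _∸_; _≤_; _<_; _≤ᵇ_; _≡ᵇ_; ∣_-_∣; z≤n; s≤s; z<s)
open import Data.Nat.Properties
open import Data.Nat.Tactic.RingSolver using (solve-∀)
open import Data.Product using (_×_; _,_)
open import Function using (_∘_; id; _⇔_; mk⇔; Equivalence)
open import Relation.Binary.PropositionalEquality
open import Relation.Nullary.Reflects using (ofʸ; ofⁿ)

bit : Bool → ℕ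
bit false = 0
bit true  = 1

bit-injective : ∀ {x y} → bit x ≡ bit y → x ≡ y
bit-injective {false} {false} _ = refl
bit-injective {true}  {true}  _ = refl

+-bit-cancel : ∀ a b {x y} → a + bit x ≡ b + bit y → (a ≡ b ⇔ x ≡ y)
+-bit-cancel a b {x} e = mk⇔
  (λ a≡b → bit-injective (+-cancelˡ-≡ a _ _ (trans e (cong (_+ _) (sym a≡b)))))
  (λ x≡y → +-cancelʳ-≡ (bit x) a b (trans e (cong (λ z → b + bit z) (sym x≡y))))

countFin : ∀ {n} → (Fin n → Bool) → ℕ
countFin {zero}  p = 0
countFin {suc n} p = bit (p Fin.zero) + countFin (p ∘ Fin.suc)

count : (ℕ → Bool) → ℕ → ℕ
count s m = countFin {m} (s ∘ toℕ)

length-filterᵇ-tabulate : ∀ {A : Set} {n} (p : A → Bool) (g : Fin n → A) →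
                          length (filterᵇ p (tabulate g)) ≡ countFin (p ∘ g)
length-filterᵇ-tabulate {n = zero}  p g = refl
length-filterᵇ-tabulate {n = suc n} p g with p (g Fin.zero)
... | true  = cong suc (length-filterᵇ-tabulate p (g ∘ Fin.suc))
... | false = length-filterᵇ-tabulate p (g ∘ Fin.suc)

count-cong : ∀ {s s′} m → (∀ k → s k ≡ s′ k) → count s m ≡ count s′ m
count-cong zero    s≗s′ = refl
count-cong (suc m) s≗s′ = cong₂ _+_ (cong bit (s≗s′ 0)) (count-cong m (s≗s′ ∘ suc))

count-+ : ∀ s a b → count s (a + b) ≡ count s a + count (s ∘ (a +_)) b
count-+ s zero    b = refl
count-+ s (suc a) b =
  trans (cong (bit (s 0) +_) (count-+ (s ∘ suc) a b)) (sym (+-assoc (bit (s 0)) _ _))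

count-suc : ∀ s m → count s (suc m) ≡ count s m + bit (s m)
count-suc s zero    = +-identityʳ (bit (s 0))
count-suc s (suc m) =
  trans (cong (bit (s 0) +_) (count-suc (s ∘ suc) m)) (sym (+-assoc (bit (s 0)) _ _))

∀-toℕ⇒∀-< : ∀ {n} (P : ℕ → Set) → (∀ (x : Fin n) → P (toℕ x)) → ∀ {a} → a < n → P a
∀-toℕ⇒∀-< P h a<n = subst P (toℕ-fromℕ< a<n) (h (fromℕ< a<n))

∣m-1+m+n∣≡1+n : ∀ m n → ∣ m - suc (m + n) ∣ ≡ suc n
∣m-1+m+n∣≡1+n m n = trans (cong (∣ m -_∣) (sym (+-suc m n))) (∣m-m+n∣≡n m (suc n))

m+n∸o≡m∸[o∸n] : ∀ m {n o} → n ≤ o → m + n ∸ o ≡ m ∸ (o ∸ n)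
m+n∸o≡m∸[o∸n] m {n} {o} n≤o = begin
  m + n ∸ o                 ≡⟨ cong (m + n ∸_) (sym (m+[n∸m]≡n n≤o)) ⟩
  m + n ∸ (n + (o ∸ n))     ≡⟨ sym (∸-+-assoc (m + n) n (o ∸ n)) ⟩
  m + n ∸ n ∸ (o ∸ n)       ≡⟨ cong (_∸ (o ∸ n)) (m+n∸n≡m m n) ⟩
  m ∸ (o ∸ n)               ∎
  where open ≡-Reasoning

<⇒≡ᵇ≡false : ∀ {m n} → n < m → (m ≡ᵇ n) ≡ false
<⇒≡ᵇ≡false {suc m} {zero}  _           = refl
<⇒≡ᵇ≡false {suc m} {suc n} (s≤s n<m) = <⇒≡ᵇ≡false n<m

toeplitz : ∀ {n} → (ℕ → Bool) → AdjMatrix n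
toeplitz s i j = s ∣ toℕ i - toℕ j ∣

symbol : List ℕ → ℕ → Bool
symbol ts d = any (_≡ᵇ d) ts

symbol-below : ∀ {n lo ts d} → StrictlyIncreasingIn n lo ts → d < lo → symbol ts d ≡ false
symbol-below []                         d<lo = refl
symbol-below {ts = _ ∷ ts} {d} ((lo≤t , _) ∷ increasing) d<lo =
  trans (cong (_∨ symbol ts d) (<⇒≡ᵇ≡false d<t)) (symbol-below increasing (m<n⇒m<1+n d<t))
  where d<t = <-≤-trans d<lo lo≤t

Palindromic : ℕ → (ℕ → Bool) → Set
Palindromic n s = ∀ t → 1 ≤ t → t < n → s t ≡ s (n ∸ t)

module _ (n : ℕ) (s : ℕ → Bool) where

  rowCount : ℕ → ℕ
  rowCount i = count (λ k → s ∣ i - k ∣) (suc i) + count (s ∘ suc) (n ∸ suc i)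

  degree-toeplitz : (x : Fin n) → degree (toeplitz s) x ≡ rowCount (toℕ x)
  degree-toeplitz x = begin
    degree (toeplitz s) x                        ≡⟨ length-filterᵇ-tabulate (toeplitz s x) id ⟩
    count row n                                  ≡⟨ cong (count row) (sym (m+[n∸m]≡n (toℕ<n x))) ⟩
    count row (suc i + (n ∸ suc i))              ≡⟨ count-+ row (suc i) (n ∸ suc i) ⟩
    count row (suc i) + count (row ∘ (suc i +_)) (n ∸ suc i)
      ≡⟨ cong (count row (suc i) +_) (count-cong (n ∸ suc i) (cong s ∘ ∣m-1+m+n∣≡1+n i)) ⟩
    rowCount i                                   ∎
    where
    open ≡-Reasoning
    i = toℕ x
    row = λ k → s ∣ i - k ∣

  rowCount-step : ∀ i → suc i < n →
                  rowCount i + bit (s (suc i)) ≡ rowCount (suc i) + bit (s (n ∸ suc i))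
  rowCount-step i 1+i<n = begin
    L + R (n ∸ suc i) + b                ≡⟨ cong (λ r → L + r + b) R-peel ⟩
    L + (R m + bit (s (n ∸ suc i))) + b  ≡⟨ interchange L (R m) b _ ⟩
    b + L + R m + bit (s (n ∸ suc i))    ∎
    where
    open ≡-Reasoning
    L = count (λ k → s ∣ i - k ∣) (suc i)
    R = count (s ∘ suc)
    m = n ∸ suc (suc i)
    b = bit (s (suc i))
    n∸[1+i]≡1+m : n ∸ suc i ≡ suc m
    n∸[1+i]≡1+m = +-∸-assoc 1 1+i<n
    R-peel : R (n ∸ suc i) ≡ R m + bit (s (n ∸ suc i))
    R-peel rewrite n∸[1+i]≡1+m = count-suc (s ∘ suc) m
    interchange : ∀ l r x y → l + (r + y) + x ≡ x + l + r + y
    interchange = solve-∀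

  rowCount-≡⇔ : ∀ i → suc i < n → (rowCount i ≡ rowCount (suc i) ⇔ s (suc i) ≡ s (n ∸ suc i))
  rowCount-≡⇔ i 1+i<n = +-bit-cancel _ _ (rowCount-step i 1+i<n)

  palindromic⇒rowCount-const : Palindromic n s → ∀ i → i < n → rowCount i ≡ rowCount 0
  palindromic⇒rowCount-const pal zero    _     = refl
  palindromic⇒rowCount-const pal (suc i) 1+i<n = trans
    (sym (Equivalence.from (rowCount-≡⇔ i 1+i<n) (pal (suc i) (s≤s z≤n) 1+i<n)))
    (palindromic⇒rowCount-const pal i (<⇒≤ 1+i<n))

  palindromic⇒regular : Palindromic n s → IsRegular (toeplitz {n} s)
  palindromic⇒regular pal = rowCount 0 , λ x →
    trans (degree-toeplitz x) (palindromic⇒rowCount-const pal (toℕ x) (toℕ<n x))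

  regular⇒palindromic : IsRegular (toeplitz {n} s) → Palindromic n s
  regular⇒palindromic (d , degree≡d) (suc i) _ 1+i<n =
    Equivalence.to (rowCount-≡⇔ i 1+i<n) (trans (rowCount≡d (<⇒≤ 1+i<n)) (sym (rowCount≡d 1+i<n)))
    where
    rowCount≡d : ∀ {j} → j < n → rowCount j ≡ d
    rowCount≡d = ∀-toℕ⇒∀-< (λ j → rowCount j ≡ d) (λ x → trans (sym (degree-toeplitz x)) (degree≡d x))

  palindromic⇒entries : Palindromic n s → ∀ {a b} → a < n → b < n → s ∣ a - b ∣ ≡ s (diffMod n a b)
  palindromic⇒entries pal {a} {b} a<n b<n with b ≤ᵇ a | ≤ᵇ-reflects-≤ b a
  ... | true  | ofʸ b≤a = cong s (m≤n⇒∣n-m∣≡n∸m b≤a)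
  ... | false | ofⁿ b≰a = begin
    s ∣ a - b ∣         ≡⟨ cong s (m≤n⇒∣m-n∣≡n∸m a≤b) ⟩
    s (b ∸ a)           ≡⟨ pal (b ∸ a) (m<n⇒0<n∸m a<b) (≤-<-trans (m∸n≤m b a) b<n) ⟩
    s (n ∸ (b ∸ a))     ≡⟨ cong s (sym (m+n∸o≡m∸[o∸n] n a≤b)) ⟩
    s (n + a ∸ b)       ∎
    where
    open ≡-Reasoning
    a<b = ≰⇒> b≰a
    a≤b = <⇒≤ a<b

  palindromic⇒circulant : s 0 ≡ false → Palindromic n s → IsCirculant (toeplitz {n} s)
  palindromic⇒circulant s0≡false pal =
    s , s0≡false , pal , λ i j → palindromic⇒entries pal (toℕ<n i) (toℕ<n j)

  circulant⇒palindromic : IsCirculant (toeplitz {n} s) → Palindromic n s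
  circulant⇒palindromic (c , _ , c-palindromic , entries) t 1≤t t<n = begin
    s t        ≡⟨ s≡c t<n ⟩
    c t        ≡⟨ c-palindromic t 1≤t t<n ⟩
    c (n ∸ t)  ≡⟨ sym (s≡c (∸-monoʳ-< 1≤t (<⇒≤ t<n))) ⟩
    s (n ∸ t)  ∎
    where
    open ≡-Reasoning
    -- Read off column 0, where diffMod n u 0 = u.
    s≡c : ∀ {u} → u < n → s u ≡ c u
    s≡c {u} u<n = trans (cong s (sym (∣-∣-identityʳ u))) (∀-toℕ⇒∀-< (λ a → s ∣ a - 0 ∣ ≡ c a)
      (λ x → ∀-toℕ⇒∀-< (λ b → s ∣ toℕ x - b ∣ ≡ c (diffMod n (toℕ x) b)) (entries x) 0<n) u<n)
      where 0<n = ≤-<-trans z≤n u<n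

theorem25 : (n : ℕ) (ts : List ℕ) → ToeplitzParams n ts →
            (IsRegular (toeplitzAdj n ts) → IsCirculant (toeplitzAdj n ts))
            × (IsCirculant (toeplitzAdj n ts) → IsRegular (toeplitzAdj n ts))
theorem25 n ts params =
    (λ regular → palindromic⇒circulant n s (symbol-below params z<s) (regular⇒palindromic n s regular))
  , (λ circulant → palindromic⇒regular n s (circulant⇒palindromic n s circulant))
  where s = symbol ts
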